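{- Let $Q$ be a quiver on nodes $1,\dots,N$ with matrix $B_Q$, and let $B(1)=B_Q$, $B(i+1)=\mu_iB(i)$. Suppose node $i$ is a sink of $B(i)$ for $i=1,2,\dots,m$. Then $Q$ has period $m$, i.e. $B(m+1)=\rho^mB_Q\rho^{ -m}$, if and only if $\tau^mB_Q\tau^{ -m}=B_Q$.
   Context: A quiver on nodes $1,\dots,N$ (no loops, no $2$-cycles) is identified with the skew-symmetric integer matrix $B=(b_{ij})$, $b_{ij}$ = number of arrows $i\to j$ minus number $j\to i$. Mutation at $k$: $\mu_kB=\tilde B$ with $\tilde b_{ij}=-b_{ij}$ if $i=k$ or $j=k$, else $\tilde b_{ij}=b_{ij}+\frac12(|b_{ik}|b_{kj}+b_{ik}|b_{kj}|)$. $\rho$: permutation matrix with $\rho_{i+1,i}=1$ ($1\le i\le N-1$), $\rho_{1,N}=1$, others $0$. $\tau$: matrix with $\tau_{i+1,i}=1$ ($1\le i\le N-1$), $\tau_{1,N}=-1$, others $0$. Node $i$ is a sink if $b_{ij}\le0$ for all $j$. -}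

module Defs where

open import Data.Nat as ℕ using (ℕ; zero; suc; _<?_)
open import Data.Fin using (Fin; toℕ; fromℕ<)
open import Data.Fin as F using ()
open import Data.Integer as ℤ using (ℤ; +_; -_; ∣_∣; _*_; _+_; _≤_; _/ℕ_)
open import Data.Bool using (if_then_else_; _∨_; _∧_)
open import Relation.Nullary using (yes; no)
open import Relation.Nullary.Decidable using (⌊_⌋)
open import Relation.Binary.PropositionalEquality using (_≡_)

-- N × N integer matrices, indexed by Fin N (node i of the paper is the
-- element of Fin N with toℕ = i - 1).
Matrix : ℕ → Set
Matrix N = Fin N → Fin N → ℤ

-- a quiver (no loops, no 2-cycles) = skew-symmetric integer matrix
SkewSymmetric : ∀ {N} → Matrix N → Set
SkewSymmetric B = ∀ i j → B i j ≡ - B j i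

sumFin : ∀ {n} → (Fin n → ℤ) → ℤ
sumFin {zero}  f = + 0
sumFin {suc n} f = f F.zero + sumFin (λ i → f (F.suc i))

_⊗_ : ∀ {N} → Matrix N → Matrix N → Matrix N
(A ⊗ C) i j = sumFin (λ k → A i k * C k j)

identity : ∀ {N} → Matrix N
identity i j = if ⌊ i F.≟ j ⌋ then + 1 else + 0

transpose : ∀ {N} → Matrix N → Matrix N
transpose A i j = A j i

_^_ : ∀ {N} → Matrix N → ℕ → Matrix N
A ^ zero  = identity
A ^ suc m = A ⊗ (A ^ m)

μ : ∀ {N} → Fin N → Matrix N → Matrix N
μ k B i j =
  if ⌊ i F.≟ k ⌋ ∨ ⌊ j F.≟ k ⌋
  then - B i j
  else B i j + ((+ ∣ B i k ∣ * B k j + B i k * + ∣ B k j ∣) /ℕ 2)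

ρ : ∀ {N} → Matrix N
ρ {N} r c =
  if ⌊ toℕ r ℕ.≟ suc (toℕ c) ⌋ ∨ (⌊ toℕ r ℕ.≟ 0 ⌋ ∧ ⌊ suc (toℕ c) ℕ.≟ N ⌋)
  then + 1 else + 0

τ : ∀ {N} → Matrix N
τ {N} r c =
  if ⌊ toℕ r ℕ.≟ suc (toℕ c) ⌋ then + 1
  else (if ⌊ toℕ r ℕ.≟ 0 ⌋ ∧ ⌊ suc (toℕ c) ℕ.≟ N ⌋ then - (+ 1) else + 0)

-- ρ and τ are orthogonal (signed permutation matrices), so ρ⁻¹ = ρᵀ and
-- τ⁻¹ = τᵀ; hence X^{-m} = (Xᵀ)^m for X ∈ {ρ, τ}.
conj : ∀ {N} → Matrix N → ℕ → Matrix N → Matrix N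
conj X m B = ((X ^ m) ⊗ B) ⊗ (transpose X ^ m)

-- mutation at the node with 0-based index k (only used for k < N)
μℕ : ∀ {N} → ℕ → Matrix N → Matrix N
μℕ {N} k B with k <? N
... | yes k<N = μ (fromℕ< k<N) B
... | no  _   = B

-- Bseq B k = B(k+1) of the paper: B(1) = B, B(i+1) = μ_i B(i)
Bseq : ∀ {N} → Matrix N → ℕ → Matrix N
Bseq B zero    = B
Bseq B (suc k) = μℕ k (Bseq B k)

IsSinkℕ : ∀ {N} → Matrix N → ℕ → Set
IsSinkℕ {N} B k = ∀ (p : k ℕ.< N) (j : Fin N) → B (fromℕ< p) j ≤ + 0

module Submission where

-- At a sink k every product b_ik b_kj in the mutation rule has b_ik ≥ 0 ≥ b_kj,
-- so μ_k merely negates row and column k. Hence B(m+1) = D B_Q D, where D is the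
-- diagonal sign matrix that is -1 exactly on the first m nodes. Both ρ and τ are
-- monomial matrices over the cyclic permutation i ↦ i - 1, so conjugating by ρ^m
-- only relabels the nodes, giving a matrix P, while conjugating by τ^m gives
-- D P D: for m ≤ N the one negative entry of τ is met exactly along the first m
-- rows. As D² = 1, B(m+1) = P if and only if D P D = B_Q.

open import Defs
open import Data.Nat using (ℕ; _≤_; _<_)
open import Data.Fin using (Fin)
open import Data.Integer using (ℤ)
open import Data.Product using (_×_; _,_)
open import Relation.Binary.PropositionalEquality using (_≡_)

open import Data.Nat as ℕ using (zero; suc; s≤s)
import Data.Nat.Properties as ℕP
open import Data.Nat.GeneralisedArithmetic using (iterate)
open import Data.Fin as F using (toℕ; fromℕ<)
import Data.Fin.Properties as FP
open import Data.Integer as ℤ using (+_; -_; ∣_∣; _*_; _+_; _/ℕ_; 0ℤ; 1ℤ; -1ℤ)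
import Data.Integer.Properties as ℤP
open import Data.Integer.Tactic.RingSolver using (solve-∀)
open import Data.Bool using (true; false; if_then_else_)
import Data.Bool.Properties as BP
open import Data.Empty using (⊥-elim)
open import Function.Bundles using (mk⇔)
open import Relation.Nullary using (Dec; yes; no)
open import Relation.Nullary.Decidable using (⌊_⌋; ⌊⌋-map′; isYes≗does; does-⇔)
open import Relation.Binary.PropositionalEquality
  using (refl; sym; trans; cong; cong₂; subst; module ≡-Reasoning)

infix 4 _≋_
_≋_ : ∀ {N} → Matrix N → Matrix N → Set
A ≋ C = ∀ i j → A i j ≡ C i j

≋-refl : ∀ {N} {A : Matrix N} → A ≋ A
≋-refl _ _ = refl

≋-sym : ∀ {N} {A C : Matrix N} → A ≋ C → C ≋ A
≋-sym A≋C i j = sym (A≋C i j)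

≋-trans : ∀ {N} {A C D : Matrix N} → A ≋ C → C ≋ D → A ≋ D
≋-trans A≋C C≋D i j = trans (A≋C i j) (C≋D i j)

⌊⌋-⇔ : {P Q : Set} (p : Dec P) (q : Dec Q) → (P → Q) → (Q → P) → ⌊ p ⌋ ≡ ⌊ q ⌋
⌊⌋-⇔ p q f g = trans (isYes≗does p) (trans (does-⇔ (mk⇔ f g) p q) (sym (isYes≗does q)))

δ : ∀ {N} → Fin N → Fin N → ℤ → ℤ
δ a b x = if ⌊ a F.≟ b ⌋ then x else 0ℤ

δ-sym : ∀ {N} (a b : Fin N) x → δ a b x ≡ δ b a x
δ-sym a b x = cong (if_then x else 0ℤ) (⌊⌋-⇔ (a F.≟ b) (b F.≟ a) sym sym)

*-δ : ∀ {N} (a b : Fin N) x y → y * δ a b x ≡ δ a b (y * x)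
*-δ a b x y with ⌊ a F.≟ b ⌋
... | true  = refl
... | false = ℤP.*-zeroʳ y

δ-* : ∀ {N} (a b : Fin N) x y → δ a b x * y ≡ δ a b (x * y)
δ-* a b x y = trans (ℤP.*-comm (δ a b x) y) (trans (*-δ a b x y) (cong (δ a b) (ℤP.*-comm y x)))

sumFin-cong : ∀ {n} {f g : Fin n → ℤ} → (∀ i → f i ≡ g i) → sumFin f ≡ sumFin g
sumFin-cong {zero}  f≗g = refl
sumFin-cong {suc n} f≗g = cong₂ _+_ (f≗g F.zero) (sumFin-cong (λ i → f≗g (F.suc i)))

sumFin-zero : ∀ n → sumFin {n} (λ _ → 0ℤ) ≡ 0ℤ
sumFin-zero zero    = refl
sumFin-zero (suc n) = trans (ℤP.+-identityˡ _) (sumFin-zero n)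

sumFin-δ : ∀ {n} (a : Fin n) (f : Fin n → ℤ) → sumFin (λ l → δ a l (f l)) ≡ f a
sumFin-δ {suc n} F.zero f = begin
  f F.zero + sumFin {n} (λ _ → 0ℤ) ≡⟨ cong (_+_ (f F.zero)) (sumFin-zero n) ⟩
  f F.zero + 0ℤ                    ≡⟨ ℤP.+-identityʳ (f F.zero) ⟩
  f F.zero                         ∎
  where open ≡-Reasoning
sumFin-δ {suc n} (F.suc a) f = begin
  0ℤ + sumFin (λ l → δ (F.suc a) (F.suc l) (f (F.suc l)))
    ≡⟨ ℤP.+-identityˡ _ ⟩
  sumFin (λ l → δ (F.suc a) (F.suc l) (f (F.suc l)))
    ≡⟨ sumFin-cong (λ l → cong (if_then f (F.suc l) else 0ℤ)
                              (⌊⌋-map′ (cong F.suc) FP.suc-injective (a F.≟ l))) ⟩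
  sumFin (λ l → δ a l (f (F.suc l)))
    ≡⟨ sumFin-δ a (λ l → f (F.suc l)) ⟩
  f (F.suc a) ∎
  where open ≡-Reasoning

⊗-cong : ∀ {N} {A A′ C C′ : Matrix N} → A ≋ A′ → C ≋ C′ → A ⊗ C ≋ A′ ⊗ C′
⊗-cong A≋A′ C≋C′ r c = sumFin-cong (λ k → cong₂ _*_ (A≋A′ r k) (C≋C′ k c))

iterate-suc : ∀ {A : Set} (f : A → A) x m → f (iterate f x m) ≡ iterate f x (suc m)
iterate-suc f x zero    = refl
iterate-suc f x (suc m) = iterate-suc f (f x) m

rowMonomial : ∀ {N} → (Fin N → Fin N) → (Fin N → ℤ) → Matrix N
rowMonomial π t r c = δ (π r) c (t r)

rowMonomial-⊗ : ∀ {N} (π : Fin N → Fin N) t (A : Matrix N) r c →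
  (rowMonomial π t ⊗ A) r c ≡ t r * A (π r) c
rowMonomial-⊗ π t A r c =
  trans (sumFin-cong (λ k → δ-* (π r) k (t r) (A k c))) (sumFin-δ (π r) (λ k → t r * A k c))

⊗-transpose-rowMonomial : ∀ {N} (π : Fin N → Fin N) t (A : Matrix N) r c →
  (A ⊗ transpose (rowMonomial π t)) r c ≡ A r (π c) * t c
⊗-transpose-rowMonomial π t A r c =
  trans (sumFin-cong (λ k → *-δ (π c) k (t c) (A r k))) (sumFin-δ (π c) (λ k → A r k * t c))

weight : ∀ {N} → (Fin N → Fin N) → (Fin N → ℤ) → ℕ → Fin N → ℤ
weight π t zero    r = 1ℤ
weight π t (suc m) r = t r * weight π t m (π r)

weight-suc-last : ∀ {N} (π : Fin N → Fin N) t m r →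
  weight π t (suc m) r ≡ t (iterate π r m) * weight π t m r
weight-suc-last π t zero    r = refl
weight-suc-last π t (suc m) r =
  trans (cong (t r *_) (weight-suc-last π t m (π r)))
        (x*[y*z]≡y*[x*z] (t r) (t (iterate π (π r) m)) (weight π t m (π r)))
  where
  x*[y*z]≡y*[x*z] : ∀ x y z → x * (y * z) ≡ y * (x * z)
  x*[y*z]≡y*[x*z] = solve-∀

weight-const-1 : ∀ {N} (π : Fin N → Fin N) m r → weight π (λ _ → 1ℤ) m r ≡ 1ℤ
weight-const-1 π zero    r = refl
weight-const-1 π (suc m) r = trans (ℤP.*-identityˡ _) (weight-const-1 π m (π r))

rescale : ∀ {N} → (Fin N → ℤ) → Matrix N → Matrix N
rescale e B i j = e i * B i j * e j

rescale-1 : ∀ {N} (B : Matrix N) → rescale (λ _ → 1ℤ) B ≋ B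
rescale-1 B i j = 1*x*1≡x (B i j)
  where
  1*x*1≡x : ∀ x → 1ℤ * x * 1ℤ ≡ x
  1*x*1≡x = solve-∀

rescale-cong : ∀ {N} {e e′ : Fin N → ℤ} (B : Matrix N) → (∀ i → e i ≡ e′ i) →
  rescale e B ≋ rescale e′ B
rescale-cong B e≗e′ i j = cong₂ (λ a b → a * B i j * b) (e≗e′ i) (e≗e′ j)

rescale-rescale : ∀ {N} (e e′ : Fin N → ℤ) (B : Matrix N) →
  rescale e (rescale e′ B) ≋ rescale (λ i → e i * e′ i) B
rescale-rescale e e′ B i j = reassoc (e i) (e′ i) (B i j) (e′ j) (e j)
  where
  reassoc : ∀ a a′ x b′ b → a * (a′ * x * b′) * b ≡ a * a′ * x * (b * b′)
  reassoc = solve-∀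

rescale-cancel : ∀ {N} (e : Fin N → ℤ) {A C : Matrix N} → (∀ i → e i * e i ≡ 1ℤ) →
  A ≋ rescale e C → rescale e A ≋ C
rescale-cancel e {A} {C} e²≡1 A≋eCe i j = begin
  e i * A i j * e j                    ≡⟨ cong (λ x → e i * x * e j) (A≋eCe i j) ⟩
  rescale e (rescale e C) i j          ≡⟨ rescale-rescale e e C i j ⟩
  rescale (λ i → e i * e i) C i j      ≡⟨ rescale-cong C e²≡1 i j ⟩
  rescale (λ _ → 1ℤ) C i j             ≡⟨ rescale-1 C i j ⟩
  C i j                                ∎
  where open ≡-Reasoning

rescale-skew : ∀ {N} (e : Fin N → ℤ) {B : Matrix N} → SkewSymmetric B → SkewSymmetric (rescale e B)
rescale-skew e {B} skew i j =
  trans (cong (λ x → e i * x * e j) (skew i j)) (a*-x*b≡-[b*x*a] (e i) (B j i) (e j))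
  where
  a*-x*b≡-[b*x*a] : ∀ a x b → a * - x * b ≡ - (b * x * a)
  a*-x*b≡-[b*x*a] = solve-∀

≋-skew : ∀ {N} {A C : Matrix N} → A ≋ C → SkewSymmetric C → SkewSymmetric A
≋-skew A≋C skew i j = trans (A≋C i j) (trans (skew i j) (cong -_ (sym (A≋C j i))))

module _ {N} {X : Matrix N} {π : Fin N → Fin N} {t : Fin N → ℤ} (X≋ : X ≋ rowMonomial π t) where

  private
    πᵐ : ℕ → Fin N → Fin N
    πᵐ m r = iterate π r m

    w : ℕ → Fin N → ℤ
    w = weight π t

  ^-rowMonomial : ∀ m → X ^ m ≋ rowMonomial (πᵐ m) (w m)
  ^-rowMonomial zero    r c = refl
  ^-rowMonomial (suc m) r c = begin
    (X ⊗ (X ^ m)) r c                    ≡⟨ ⊗-cong X≋ (≋-refl {A = X ^ m}) r c ⟩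
    (rowMonomial π t ⊗ (X ^ m)) r c      ≡⟨ rowMonomial-⊗ π t (X ^ m) r c ⟩
    t r * (X ^ m) (π r) c                ≡⟨ cong (t r *_) (^-rowMonomial m (π r) c) ⟩
    t r * δ (πᵐ (suc m) r) c (w m (π r)) ≡⟨ *-δ (πᵐ (suc m) r) c (w m (π r)) (t r) ⟩
    δ (πᵐ (suc m) r) c (w (suc m) r)     ∎
    where open ≡-Reasoning

  transpose-^-rowMonomial : ∀ m → transpose X ^ m ≋ transpose (rowMonomial (πᵐ m) (w m))
  transpose-^-rowMonomial zero    r c = δ-sym r c 1ℤ
  transpose-^-rowMonomial (suc m) r c = begin
    (transpose X ⊗ (transpose X ^ m)) r c
      ≡⟨ ⊗-cong (≋-refl {A = transpose X}) (transpose-^-rowMonomial m) r c ⟩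
    (transpose X ⊗ transpose (rowMonomial (πᵐ m) (w m))) r c
      ≡⟨ ⊗-transpose-rowMonomial (πᵐ m) (w m) (transpose X) r c ⟩
    X (πᵐ m c) r * w m c
      ≡⟨ cong (_* w m c) (X≋ (πᵐ m c) r) ⟩
    δ (π (πᵐ m c)) r (t (πᵐ m c)) * w m c
      ≡⟨ δ-* (π (πᵐ m c)) r (t (πᵐ m c)) (w m c) ⟩
    δ (π (πᵐ m c)) r (t (πᵐ m c) * w m c)
      ≡⟨ cong₂ (λ a x → δ a r x) (iterate-suc π c m) (sym (weight-suc-last π t m c)) ⟩
    δ (πᵐ (suc m) c) r (w (suc m) c) ∎
    where open ≡-Reasoning

  conj-rowMonomial : ∀ m (B : Matrix N) → conj X m B ≋ rescale (w m) (λ i j → B (πᵐ m i) (πᵐ m j))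
  conj-rowMonomial m B i j = begin
    conj X m B i j
      ≡⟨ ⊗-cong (⊗-cong (^-rowMonomial m) ≋-refl) (transpose-^-rowMonomial m) i j ⟩
    ((rowMonomial (πᵐ m) (w m) ⊗ B) ⊗ transpose (rowMonomial (πᵐ m) (w m))) i j
      ≡⟨ ⊗-transpose-rowMonomial (πᵐ m) (w m) (rowMonomial (πᵐ m) (w m) ⊗ B) i j ⟩
    (rowMonomial (πᵐ m) (w m) ⊗ B) i (πᵐ m j) * w m j
      ≡⟨ cong (_* w m j) (rowMonomial-⊗ (πᵐ m) (w m) B i (πᵐ m j)) ⟩
    w m i * B (πᵐ m i) (πᵐ m j) * w m j ∎
    where open ≡-Reasoning

cyclicPred : ∀ {N} → Fin N → Fin N
cyclicPred {suc n} F.zero    = F.fromℕ n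
cyclicPred {suc n} (F.suc i) = F.inject₁ i

⌊⌋-toℕ-last : ∀ {n} (c : Fin (suc n)) → ⌊ suc (toℕ c) ℕ.≟ suc n ⌋ ≡ ⌊ F.fromℕ n F.≟ c ⌋
⌊⌋-toℕ-last {n} c = ⌊⌋-⇔ (suc (toℕ c) ℕ.≟ suc n) (F.fromℕ n F.≟ c)
  (λ e → FP.toℕ-injective (trans (FP.toℕ-fromℕ n) (sym (ℕP.suc-injective e))))
  (λ e → cong suc (trans (sym (cong toℕ e)) (FP.toℕ-fromℕ n)))

⌊⌋-toℕ-inject₁ : ∀ {n} (r : Fin n) (c : Fin (suc n)) →
  ⌊ suc (toℕ r) ℕ.≟ suc (toℕ c) ⌋ ≡ ⌊ F.inject₁ r F.≟ c ⌋
⌊⌋-toℕ-inject₁ r c = ⌊⌋-⇔ (suc (toℕ r) ℕ.≟ suc (toℕ c)) (F.inject₁ r F.≟ c)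
  (λ e → FP.toℕ-injective (trans (FP.toℕ-inject₁ r) (ℕP.suc-injective e)))
  (λ e → cong suc (trans (sym (FP.toℕ-inject₁ r)) (cong toℕ e)))

ρ≋rowMonomial : ∀ {N} → ρ {N} ≋ rowMonomial cyclicPred (λ _ → 1ℤ)
ρ≋rowMonomial F.zero    c = cong (if_then 1ℤ else 0ℤ) (⌊⌋-toℕ-last c)
ρ≋rowMonomial (F.suc r) c = cong (if_then 1ℤ else 0ℤ)
  (trans (BP.∨-identityʳ _) (⌊⌋-toℕ-inject₁ r c))

τ-sign : ∀ {N} → Fin N → ℤ
τ-sign F.zero    = -1ℤ
τ-sign (F.suc _) = 1ℤ

τ≋rowMonomial : ∀ {N} → τ {N} ≋ rowMonomial cyclicPred τ-sign
τ≋rowMonomial F.zero    c = cong (if_then -1ℤ else 0ℤ) (⌊⌋-toℕ-last c)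
τ≋rowMonomial (F.suc r) c = cong (if_then 1ℤ else 0ℤ) (⌊⌋-toℕ-inject₁ r c)

flipFirst : ∀ {N} → ℕ → Fin N → ℤ
flipFirst zero    i         = 1ℤ
flipFirst (suc m) F.zero    = -1ℤ
flipFirst (suc m) (F.suc i) = flipFirst m i

flipFirst-fromℕ : ∀ {m n} → m ≤ n → flipFirst m (F.fromℕ n) ≡ 1ℤ
flipFirst-fromℕ {zero}           _         = refl
flipFirst-fromℕ {suc m} {suc n} (s≤s m≤n) = flipFirst-fromℕ m≤n

flipFirst-inject₁ : ∀ {n} m (i : Fin n) → flipFirst m (F.inject₁ i) ≡ flipFirst m i
flipFirst-inject₁ zero    i         = refl
flipFirst-inject₁ (suc m) F.zero    = refl
flipFirst-inject₁ (suc m) (F.suc i) = flipFirst-inject₁ m i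

flipFirst-involutive : ∀ {N} m (i : Fin N) → flipFirst m i * flipFirst m i ≡ 1ℤ
flipFirst-involutive zero    i         = refl
flipFirst-involutive (suc m) F.zero    = refl
flipFirst-involutive (suc m) (F.suc i) = flipFirst-involutive m i

-- The walk i, i - 1, …, i - m + 1 (mod N) passes node 1, the only row where τ
-- carries the sign -1, exactly when i < m, and at most once since m ≤ N.
weight-τ : ∀ {N} m → m ≤ N → (i : Fin N) → weight cyclicPred τ-sign m i ≡ flipFirst m i
weight-τ zero    _    i         = refl
weight-τ (suc m) m<N  F.zero    = cong (-1ℤ *_)
  (trans (weight-τ m (ℕP.<⇒≤ m<N) _) (flipFirst-fromℕ (ℕP.≤-pred m<N)))
weight-τ (suc m) m<N  (F.suc i) = trans (ℤP.*-identityˡ _)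
  (trans (weight-τ m (ℕP.<⇒≤ m<N) (F.inject₁ i)) (flipFirst-inject₁ m i))

negateAt : ∀ {N} → Fin N → Fin N → ℤ
negateAt k i = if ⌊ i F.≟ k ⌋ then -1ℤ else 1ℤ

flipFirst-suc : ∀ {m N} (m<N : m < N) (i : Fin N) →
  flipFirst (suc m) i ≡ negateAt (fromℕ< m<N) i * flipFirst m i
flipFirst-suc {zero}  {suc n} _   F.zero    = refl
flipFirst-suc {zero}  {suc n} _   (F.suc i) = refl
flipFirst-suc {suc m} {suc n} _   F.zero    = refl
flipFirst-suc {suc m} {suc n} m<N (F.suc i) =
  trans (flipFirst-suc (ℕ.s<s⁻¹ m<N) i)
        (cong (λ b → (if b then -1ℤ else 1ℤ) * flipFirst m i)
              (sym (⌊⌋-map′ (cong F.suc) FP.suc-injective (i F.≟ fromℕ< (ℕ.s<s⁻¹ m<N)))))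

sink-correction : ∀ x y → 0ℤ ℤ.≤ x → y ℤ.≤ 0ℤ → + ∣ x ∣ * y + x * + ∣ y ∣ ≡ 0ℤ
sink-correction x y 0≤x y≤0 = begin
  + ∣ x ∣ * y + x * + ∣ y ∣ ≡⟨ cong₂ (λ a b → a * y + x * b) (ℤP.0≤i⇒+∣i∣≡i 0≤x) ∣y∣≡-y ⟩
  x * y + x * - y           ≡⟨ x*y+x*-y≡0 x y ⟩
  0ℤ                        ∎
  where
  open ≡-Reasoning
  ∣y∣≡-y : + ∣ y ∣ ≡ - y
  ∣y∣≡-y = trans (cong +_ (sym (ℤP.∣-i∣≡∣i∣ y))) (ℤP.0≤i⇒+∣i∣≡i (ℤP.neg-mono-≤ y≤0))
  x*y+x*-y≡0 : ∀ x y → x * y + x * - y ≡ 0ℤ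
  x*y+x*-y≡0 = solve-∀

μ-sink : ∀ {N} {B : Matrix N} {k : Fin N} → SkewSymmetric B → (∀ j → B k j ℤ.≤ 0ℤ) →
  μ k B ≋ rescale (negateAt k) B
μ-sink {B = B} {k} skew sink i j with i F.≟ k | j F.≟ k
... | yes refl | yes refl = trans (sym (skew k k)) (x≡-1*x*-1 (B k k))
  where
  x≡-1*x*-1 : ∀ x → x ≡ -1ℤ * x * -1ℤ
  x≡-1*x*-1 = solve-∀
... | yes refl | no _     = -x≡-1*x*1 (B k j)
  where
  -x≡-1*x*1 : ∀ x → - x ≡ -1ℤ * x * 1ℤ
  -x≡-1*x*1 = solve-∀
... | no _     | yes refl = -x≡1*x*-1 (B i k)
  where
  -x≡1*x*-1 : ∀ x → - x ≡ 1ℤ * x * -1ℤ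
  -x≡1*x*-1 = solve-∀
... | no _     | no _     = begin
  B i j + (+ ∣ B i k ∣ * B k j + B i k * + ∣ B k j ∣) /ℕ 2
    ≡⟨ cong (λ c → B i j + c /ℕ 2) (sink-correction (B i k) (B k j) 0≤Bik (sink j)) ⟩
  B i j + 0ℤ
    ≡⟨ x+0≡1*x*1 (B i j) ⟩
  1ℤ * B i j * 1ℤ ∎
  where
  open ≡-Reasoning
  0≤Bik : 0ℤ ℤ.≤ B i k
  0≤Bik = subst (0ℤ ℤ.≤_) (sym (skew i k)) (ℤP.neg-mono-≤ (sink i))
  x+0≡1*x*1 : ∀ x → x + 0ℤ ≡ 1ℤ * x * 1ℤ
  x+0≡1*x*1 = solve-∀

μℕ≡μ : ∀ {N} {m} (m<N : m < N) (B : Matrix N) → μℕ m B ≡ μ (fromℕ< m<N) B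
μℕ≡μ {N} {m} m<N B with m ℕ.<? N
... | yes _  = refl
... | no m≮N = ⊥-elim (m≮N m<N)

Bseq-sinks : ∀ {N} {B : Matrix N} m → SkewSymmetric B → m ≤ N →
  (∀ i → i < m → IsSinkℕ (Bseq B i) i) → Bseq B m ≋ rescale (flipFirst m) B
Bseq-sinks {B = B} zero    skew _   _     i j = sym (rescale-1 B i j)
Bseq-sinks {B = B} (suc m) skew m<N sinks i j = begin
  μℕ m (Bseq B m) i j
    ≡⟨ cong (λ M → M i j) (μℕ≡μ m<N (Bseq B m)) ⟩
  μ k (Bseq B m) i j
    ≡⟨ μ-sink (≋-skew IH (rescale-skew (flipFirst m) skew)) (sinks m (ℕP.n<1+n m) m<N) i j ⟩
  rescale (negateAt k) (Bseq B m) i j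
    ≡⟨ cong (λ x → negateAt k i * x * negateAt k j) (IH i j) ⟩
  rescale (negateAt k) (rescale (flipFirst m) B) i j
    ≡⟨ rescale-rescale (negateAt k) (flipFirst m) B i j ⟩
  rescale (λ i → negateAt k i * flipFirst m i) B i j
    ≡⟨ rescale-cong B (λ i → sym (flipFirst-suc m<N i)) i j ⟩
  rescale (flipFirst (suc m)) B i j ∎
  where
  open ≡-Reasoning
  k = fromℕ< m<N
  IH : Bseq B m ≋ rescale (flipFirst m) B
  IH = Bseq-sinks m skew (ℕP.<⇒≤ m<N) (λ i i<m → sinks i (ℕP.m<n⇒m<1+n i<m))

mainTheorem8 : (N m : ℕ) (BQ : Matrix N) → SkewSymmetric BQ → m ≤ N →
    (∀ i → i < m → IsSinkℕ (Bseq BQ i) i) →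
    ((∀ (i j : Fin N) → Bseq BQ m i j ≡ conj ρ m BQ i j) →
       (∀ (i j : Fin N) → conj τ m BQ i j ≡ BQ i j))
    × ((∀ (i j : Fin N) → conj τ m BQ i j ≡ BQ i j) →
       (∀ (i j : Fin N) → Bseq BQ m i j ≡ conj ρ m BQ i j))
mainTheorem8 N m BQ skew m≤N sinks = period⇒τ-invariant , τ-invariant⇒period
  where
  D : Fin N → ℤ
  D = flipFirst m

  rotated : Matrix N
  rotated i j = BQ (iterate cyclicPred i m) (iterate cyclicPred j m)

  Bseq≋ : Bseq BQ m ≋ rescale D BQ
  Bseq≋ = Bseq-sinks m skew m≤N sinks

  conjρ≋ : conj ρ m BQ ≋ rotated
  conjρ≋ = ≋-trans (conj-rowMonomial ρ≋rowMonomial m BQ)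
                   (≋-trans (rescale-cong rotated (weight-const-1 cyclicPred m)) (rescale-1 rotated))

  conjτ≋ : conj τ m BQ ≋ rescale D rotated
  conjτ≋ = ≋-trans (conj-rowMonomial τ≋rowMonomial m BQ) (rescale-cong rotated (weight-τ m m≤N))

  period⇒τ-invariant : Bseq BQ m ≋ conj ρ m BQ → conj τ m BQ ≋ BQ
  period⇒τ-invariant period = ≋-trans conjτ≋
    (rescale-cancel D (flipFirst-involutive m) (≋-trans (≋-sym conjρ≋) (≋-trans (≋-sym period) Bseq≋)))

  τ-invariant⇒period : conj τ m BQ ≋ BQ → Bseq BQ m ≋ conj ρ m BQ
  τ-invariant⇒period invariant = ≋-trans Bseq≋
    (≋-trans (rescale-cancel D (flipFirst-involutive m) (≋-trans (≋-sym invariant) conjτ≋)) (≋-sym conjρ≋))
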